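{- Let $n\ge1$. On the finite chain $C_n$: (i) there are exactly $2^n$ binary operations satisfying (S1) and (S2); (ii) there is exactly one binary operation satisfying (S1)–(S3), namely $\sigma_n(a,b)=0$ if $a=0$ and $\sigma_n(a,b)=b$ if $a\ne0$; (iii) if $n\ge2$, there is no binary operation satisfying (S1)–(S4); (iv) $C_n$ admits a sequential product if and only if $n=1$.
   Context: For $n\ge 1$, $C_n=\{0,e,2e,\dots,ne=1\}$ is the effect algebra with partial addition $(ie)\oplus(je)=(i+j)e$ defined (written $\perp$) iff $i+j\le n$, top $1=ne$, and orthosupplement $(ie)'=(n-i)e$. For a total binary operation $\circ$, $a\mid b$ means $a\circ b=b\circ a$. Axioms: (S1) $b\perp c\Rightarrow a\circ(b\oplus c)=(a\circ b)\oplus(a\circ c)$; (S2) $1\circ a=a$; (S3) $a\circ b=0\Rightarrow a\circ b=b\circ a$; (S4) if $a\mid b$ then $a\mid b'$ and $a\circ(b\circ c)=(a\circ b)\circ c$ for all $c$; (S5) if $c\mid a$ and $c\mid b$ then $c\mid(a\circ b)$, and $c\mid(a\oplus b)$ whenever $a\perp b$. A sequential product is a total binary operation satisfying (S1)–(S5). -}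

module Defs where

open import Data.Nat using (ℕ; suc; _+_; _≤_)
open import Data.Fin using (Fin; zero; toℕ; fromℕ; opposite)
open import Data.Product using (Σ; ∃; _×_)
open import Relation.Binary.PropositionalEquality using (_≡_)
open import Relation.Nullary using (¬_)

-- Elements of C_n: ie is represented by i : Fin (suc n).
C : ℕ → Set
C n = Fin (suc n)

Op : ℕ → Set
Op n = C n → C n → C n

module _ {n : ℕ} where
  𝟘 : C n
  𝟘 = zero

  𝟙 : C n
  𝟙 = fromℕ n

  _′ : C n → C n
  a ′ = opposite a

  _⊥_ : C n → C n → Set
  a ⊥ b = toℕ a + toℕ b ≤ n

  -- IsSum a b d : a ⊥ b and a ⊕ b = d  (the sum a + b is defined and equals d)
  IsSum : C n → C n → C n → Set
  IsSum a b d = toℕ a + toℕ b ≡ toℕ d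

  Comm : Op n → C n → C n → Set
  Comm _∘_ a b = a ∘ b ≡ b ∘ a

  -- (S1): b ⊥ c ⇒ a∘(b⊕c) = (a∘b) ⊕ (a∘c)  (in particular the right side is defined)
  S1 : Op n → Set
  S1 _∘_ = ∀ a b c d → IsSum b c d → IsSum (a ∘ b) (a ∘ c) (a ∘ d)

  S2 : Op n → Set
  S2 _∘_ = ∀ a → 𝟙 ∘ a ≡ a

  S3 : Op n → Set
  S3 _∘_ = ∀ a b → a ∘ b ≡ 𝟘 → a ∘ b ≡ b ∘ a

  S4 : Op n → Set
  S4 _∘_ = ∀ a b → Comm _∘_ a b →
             Comm _∘_ a (b ′) × (∀ c → a ∘ (b ∘ c) ≡ (a ∘ b) ∘ c)

  S5 : Op n → Set
  S5 _∘_ = ∀ a b c → Comm _∘_ c a → Comm _∘_ c b →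
             Comm _∘_ c (a ∘ b) × (∀ d → IsSum a b d → Comm _∘_ c d)

  SequentialProduct : Op n → Set
  SequentialProduct o = S1 o × S2 o × S3 o × S4 o × S5 o

  _≗op_ : Op n → Op n → Set
  f ≗op g = ∀ a b → f a b ≡ g a b

  σ : Op n
  σ zero    b = zero
  σ (Fin.suc a) b = b

  ExactlyOps : ℕ → (Op n → Set) → Set
  ExactlyOps k P =
    Σ (Fin k → Op n) λ e →
      (∀ i → P (e i)) ×
      (∀ i j → e i ≗op e j → i ≡ j) ×
      (∀ f → P f → ∃ λ i → f ≗op e i)

-- By (S1) every row b ↦ a ∘ b of the multiplication table is additive, so it sends ie to
-- i(a ∘ e); as n(a ∘ e) ≤ n, the slope a ∘ e is 0 or e, and the row is the zero map or the
-- identity. (S2) makes the row of 1 the identity and leaves the other n rows free, giving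
-- 2^n operations. (S3) forces the row of 0 to vanish and every other row to be the identity,
-- which is σ. For n ≥ 2, e commutes with 0 under σ but not with 0′ = 1, contradicting (S4);
-- for n = 1, σ is commutative and associative, which yields (S4) and (S5).
module Submission where

open import Defs
open import Algebra.Definitions using (Commutative; Associative)
open import Data.Empty using (⊥-elim)
open import Data.Fin using (Fin; zero; suc; toℕ; inject₁; punchIn; punchOut; finToFun; funToFin; combine)
open import Data.Fin.Induction using (<-weakInduction)
open import Data.Fin.Properties
  using (_≟_; 0≢1+n; suc-injective; toℕ-injective; toℕ-fromℕ; toℕ-inject₁; toℕ≤pred[n];
         punchIn-punchOut; funToFin-finToFin; finToFun-funToFin)
open import Data.Nat using (ℕ; _≤_; _^_; _+_; _*_; s≤s; z≤n)
open import Data.Nat.Properties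
  using (+-comm; +-identityʳ; +-cancelˡ-≡; *-identityʳ; *-zeroʳ; *-cancelˡ-≤; n≤1⇒n≡0∨n≡1)
open import Data.Product using (_×_; ∃; _,_; proj₁; proj₂)
open import Data.Sum using (inj₁; inj₂)
open import Data.Vec.Functional using (insertAt)
open import Data.Vec.Functional.Properties using (insertAt-lookup; insertAt-punchIn)
open import Function using (_∘_)
open import Function.Bundles using (_⇔_; mk⇔)
open import Relation.Binary.PropositionalEquality
  using (_≡_; refl; sym; trans; cong; cong₂; cong-app; subst; subst₂; _≗_; module ≡-Reasoning)
open import Relation.Nullary using (¬_; yes; no)

open ≡-Reasoning

private
  variable
    k m n : ℕ

funToFin-cong : {s t : Fin k → Fin m} → s ≗ t → funToFin s ≡ funToFin t
funToFin-cong {ℕ.zero}  s≗t = refl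
funToFin-cong {ℕ.suc k} s≗t = cong₂ combine (s≗t zero) (funToFin-cong (s≗t ∘ suc))

exactlyOps-^ : {P : Op n → Set} (e : (Fin k → Fin m) → Op n) →
               (∀ {s t} → s ≗ t → e s ≗op e t) →
               (∀ s → P (e s)) →
               (∀ {s t} → e s ≗op e t → s ≗ t) →
               (∀ f → P f → ∃ λ s → f ≗op e s) →
               ExactlyOps (m ^ k) P
exactlyOps-^ {k = k} {m = m} {P = P} e e-cong e-sound e-injective e-complete =
  e ∘ finToFun , e-sound ∘ finToFun , injective , complete
  where
  injective : ∀ i j → e (finToFun i) ≗op e (finToFun j) → i ≡ j
  injective i j eq = begin
    i                                    ≡⟨ funToFin-finToFin {k} {m} i ⟨
    funToFin (finToFun {m} {k} i)        ≡⟨ funToFin-cong (e-injective eq) ⟩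
    funToFin (finToFun {m} {k} j)        ≡⟨ funToFin-finToFin {k} {m} j ⟩
    j                                    ∎
  complete : ∀ f → P f → ∃ λ i → f ≗op e (finToFun i)
  complete f Pf with e-complete f Pf
  ... | s , f≗e[s] = funToFin s , λ a b →
    trans (f≗e[s] a b) (e-cong (λ k → sym (finToFun-funToFin s k)) a b)

Additive : (C n → C n) → Set
Additive f = ∀ b c d → IsSum b c d → IsSum (f b) (f c) (f d)

scale : Fin 2 → C n → C n
scale zero       _ = zero
scale (suc zero) b = b

scale-additive : (r : Fin 2) → Additive {n} (scale r)
scale-additive zero       _ _ _ _     = refl
scale-additive (suc zero) _ _ _ b⊕c≡d = b⊕c≡d

additive-zero : {f : C n → C n} → Additive f → f zero ≡ zero
additive-zero {f = f} add =
  toℕ-injective (+-cancelˡ-≡ (toℕ (f zero)) _ 0 (trans (add zero zero zero refl) (sym (+-identityʳ _))))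

additive-linear : {f : C (ℕ.suc m) → C (ℕ.suc m)} → Additive f →
                  ∀ b → toℕ (f b) ≡ toℕ b * toℕ (f (suc zero))
additive-linear {f = f} add = <-weakInduction P (cong toℕ (additive-zero add)) step
  where
  slope = toℕ (f (suc zero))
  P : C _ → Set
  P b = toℕ (f b) ≡ toℕ b * slope
  step : ∀ i → P (inject₁ i) → P (suc i)
  step i ih = begin
    toℕ (f (suc i))                 ≡⟨ add (inject₁ i) (suc zero) (suc i) i⊕e≡i+1 ⟨
    toℕ (f (inject₁ i)) + slope     ≡⟨ cong (_+ slope) ih ⟩
    toℕ (inject₁ i) * slope + slope ≡⟨ cong (λ x → x * slope + slope) (toℕ-inject₁ i) ⟩
    toℕ i * slope + slope           ≡⟨ +-comm _ slope ⟩
    ℕ.suc (toℕ i) * slope           ∎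
    where
    i⊕e≡i+1 : toℕ (inject₁ i) + 1 ≡ ℕ.suc (toℕ i)
    i⊕e≡i+1 = trans (cong (_+ 1) (toℕ-inject₁ i)) (+-comm (toℕ i) 1)

additive-slope≤1 : {f : C (ℕ.suc m) → C (ℕ.suc m)} → Additive f → toℕ (f (suc zero)) ≤ 1
additive-slope≤1 {m} {f} add =
  *-cancelˡ-≤ (ℕ.suc m) (subst₂ _≤_ f𝟙≡n*slope (sym (*-identityʳ _)) (toℕ≤pred[n] (f 𝟙)))
  where
  f𝟙≡n*slope : toℕ (f 𝟙) ≡ ℕ.suc m * toℕ (f (suc zero))
  f𝟙≡n*slope = trans (additive-linear add 𝟙) (cong (_* toℕ (f (suc zero))) (toℕ-fromℕ (ℕ.suc m)))

additive⇒scale : {f : C (ℕ.suc m) → C (ℕ.suc m)} → Additive f → ∃ λ r → f ≗ scale r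
additive⇒scale {f = f} add with n≤1⇒n≡0∨n≡1 (additive-slope≤1 add)
... | inj₁ slope≡0 = zero , λ b → toℕ-injective
  (trans (additive-linear add b) (trans (cong (toℕ b *_) slope≡0) (*-zeroʳ (toℕ b))))
... | inj₂ slope≡1 = suc zero , λ b → toℕ-injective
  (trans (additive-linear add b) (trans (cong (toℕ b *_) slope≡1) (*-identityʳ (toℕ b))))

scale-𝟙-injective : ∀ r t → scale {ℕ.suc m} r 𝟙 ≡ scale t 𝟙 → r ≡ t
scale-𝟙-injective zero       zero       _  = refl
scale-𝟙-injective zero       (suc zero) eq = ⊥-elim (0≢1+n eq)
scale-𝟙-injective (suc zero) zero       eq = ⊥-elim (0≢1+n (sym eq))
scale-𝟙-injective (suc zero) (suc zero) _  = refl

fromRows : (Fin n → Fin 2) → Op n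
fromRows s a = scale (insertAt s 𝟙 (suc zero) a)

fromRows-𝟙 : (s : Fin n → Fin 2) → fromRows s 𝟙 ≡ scale (suc zero)
fromRows-𝟙 s = cong scale (insertAt-lookup s 𝟙 (suc zero))

fromRows-punchIn : (s : Fin n → Fin 2) (k : Fin n) → fromRows s (punchIn 𝟙 k) ≡ scale (s k)
fromRows-punchIn s k = cong scale (insertAt-punchIn s 𝟙 (suc zero) k)

fromRows-S1 : (s : Fin n → Fin 2) → S1 (fromRows s)
fromRows-S1 s a = scale-additive (insertAt s 𝟙 (suc zero) a)

fromRows-S2 : (s : Fin n → Fin 2) → S2 (fromRows s)
fromRows-S2 s = cong-app (fromRows-𝟙 s)

fromRows-unique : {f : Op n} {s : Fin n → Fin 2} →
                  S2 f → (∀ k → f (punchIn 𝟙 k) ≗ scale (s k)) → f ≗op fromRows s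
fromRows-unique {f = f} {s = s} s2 rows a b with 𝟙 ≟ a
... | yes refl = trans (s2 b) (sym (cong-app (fromRows-𝟙 s) b))
... | no 𝟙≢a = subst (λ a → f a b ≡ fromRows s a b) (punchIn-punchOut 𝟙≢a) (begin
  f (punchIn 𝟙 i) b            ≡⟨ rows i b ⟩
  scale (s i) b                ≡⟨ cong-app (fromRows-punchIn s i) b ⟨
  fromRows s (punchIn 𝟙 i) b   ∎)
  where i = punchOut 𝟙≢a

fromRows-cong : {s t : Fin n → Fin 2} → s ≗ t → fromRows s ≗op fromRows t
fromRows-cong {s = s} {t = t} s≗t = fromRows-unique {f = fromRows s} (fromRows-S2 s) λ k b →
  trans (cong-app (fromRows-punchIn s k) b) (cong (λ r → scale r b) (s≗t k))

fromRows-injective : {s t : Fin (ℕ.suc m) → Fin 2} → fromRows s ≗op fromRows t → s ≗ t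
fromRows-injective {s = s} {t} eq k = scale-𝟙-injective (s k) (t k) (begin
  scale (s k) 𝟙                ≡⟨ cong-app (fromRows-punchIn s k) 𝟙 ⟨
  fromRows s (punchIn 𝟙 k) 𝟙   ≡⟨ eq (punchIn 𝟙 k) 𝟙 ⟩
  fromRows t (punchIn 𝟙 k) 𝟙   ≡⟨ cong-app (fromRows-punchIn t k) 𝟙 ⟩
  scale (t k) 𝟙                ∎)

S1∧S2⇒≗fromRows : {f : Op (ℕ.suc m)} → S1 f → S2 f → ∃ λ s → f ≗op fromRows s
S1∧S2⇒≗fromRows s1 s2 = proj₁ ∘ row , fromRows-unique s2 (proj₂ ∘ row)
  where row = λ k → additive⇒scale (s1 (punchIn 𝟙 k))

exactlyOps-S1∧S2 : ExactlyOps {ℕ.suc m} (2 ^ ℕ.suc m) (λ o → S1 o × S2 o)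
exactlyOps-S1∧S2 = exactlyOps-^ fromRows fromRows-cong (λ s → fromRows-S1 s , fromRows-S2 s)
  fromRows-injective (λ f (s1 , s2) → S1∧S2⇒≗fromRows s1 s2)

σ-S1 : S1 (σ {n})
σ-S1 zero    _ _ _ _     = refl
σ-S1 (suc _) _ _ _ b⊕c≡d = b⊕c≡d

σ-S2 : S2 (σ {n})
σ-S2 {ℕ.zero}  zero = refl
σ-S2 {ℕ.suc _} _    = refl

σ-S3 : S3 (σ {n})
σ-S3 zero    zero    _  = refl
σ-S3 zero    (suc _) _  = refl
σ-S3 (suc _) zero    _  = refl
σ-S3 (suc _) (suc _) ()

S1∧S2∧S3⇒≗σ : (o : Op (ℕ.suc m)) → S1 o → S2 o → S3 o → o ≗op σ
S1∧S2∧S3⇒≗σ o s1 s2 s3 zero b with additive⇒scale (s1 zero)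
... | zero     , row = row b
... | suc zero , row = ⊥-elim (0≢1+n (begin
  zero       ≡⟨ s2 zero ⟨
  o 𝟙 zero   ≡⟨ s3 𝟙 zero (s2 zero) ⟩
  o zero 𝟙   ≡⟨ row 𝟙 ⟩
  𝟙          ∎))
S1∧S2∧S3⇒≗σ o s1 s2 s3 (suc a) b with additive⇒scale (s1 (suc a))
... | suc zero , row = row b
... | zero     , row = ⊥-elim (0≢1+n (begin
  zero          ≡⟨ row 𝟙 ⟨
  o (suc a) 𝟙   ≡⟨ s3 (suc a) 𝟙 (row 𝟙) ⟩
  o 𝟙 (suc a)   ≡⟨ s2 (suc a) ⟩
  suc a         ∎))

S1∧S2∧S3⇒¬S4 : 2 ≤ n → (o : Op n) → ¬ (S1 o × S2 o × S3 o × S4 o)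
S1∧S2∧S3⇒¬S4 (s≤s (s≤s z≤n)) o (s1 , s2 , s3 , s4) = 0≢1+n (sym (suc-injective 𝟙≡e))
  where
  e = suc zero
  o≗σ = S1∧S2∧S3⇒≗σ o s1 s2 s3
  e∣0 : Comm o e zero
  e∣0 = trans (o≗σ e zero) (sym (o≗σ zero e))
  𝟙≡e : 𝟙 ≡ e
  𝟙≡e = begin
    𝟙       ≡⟨ o≗σ e 𝟙 ⟨
    o e 𝟙   ≡⟨ proj₁ (s4 e zero e∣0) ⟩  -- zero ′ computes to 𝟙
    o 𝟙 e   ≡⟨ s2 e ⟩
    e       ∎

σ-assoc : Associative _≡_ (σ {n})
σ-assoc zero    _ _ = refl
σ-assoc (suc _) _ _ = refl

σ-comm : Commutative _≡_ (σ {1})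
σ-comm zero       zero       = refl
σ-comm zero       (suc zero) = refl
σ-comm (suc zero) zero       = refl
σ-comm (suc zero) (suc zero) = refl

comm∧assoc⇒S4 : {o : Op n} → Commutative _≡_ o → Associative _≡_ o → S4 o
comm∧assoc⇒S4 comm assoc a b _ = comm a (b ′) , λ c → sym (assoc a b c)

comm⇒S5 : {o : Op n} → Commutative _≡_ o → S5 o
comm⇒S5 {o = o} comm a b c _ _ = comm c (o a b) , λ d _ → comm c d

σ-sequentialProduct : SequentialProduct (σ {1})
σ-sequentialProduct = σ-S1 , σ-S2 , σ-S3 , comm∧assoc⇒S4 σ-comm σ-assoc , comm⇒S5 σ-comm

sequentialProduct⇔n≡1 : (∃ λ (o : Op (ℕ.suc m)) → SequentialProduct o) ⇔ (ℕ.suc m ≡ 1)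
sequentialProduct⇔n≡1 = mk⇔ sequentialProduct⇒n≡1 λ { refl → σ , σ-sequentialProduct }
  where
  sequentialProduct⇒n≡1 : ∀ {m} → (∃ λ (o : Op (ℕ.suc m)) → SequentialProduct o) → ℕ.suc m ≡ 1
  sequentialProduct⇒n≡1 {ℕ.zero}  _                           = refl
  sequentialProduct⇒n≡1 {ℕ.suc m} (o , s1 , s2 , s3 , s4 , _) =
    ⊥-elim (S1∧S2∧S3⇒¬S4 (s≤s (s≤s z≤n)) o (s1 , s2 , s3 , s4))

corollary7p2 : (n : ℕ) → 1 ≤ n →
      ExactlyOps {n} (2 ^ n) (λ o → S1 o × S2 o)
    × ((S1 (σ {n}) × S2 (σ {n}) × S3 (σ {n}))
       × (∀ (o : Op n) → S1 o → S2 o → S3 o → o ≗op σ))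
    × (2 ≤ n → ∀ (o : Op n) → ¬ (S1 o × S2 o × S3 o × S4 o))
    × ((∃ λ (o : Op n) → SequentialProduct o) ⇔ (n ≡ 1))
corollary7p2 (ℕ.suc m) (s≤s z≤n) =
  exactlyOps-S1∧S2 , ((σ-S1 , σ-S2 , σ-S3) , S1∧S2∧S3⇒≗σ) , S1∧S2∧S3⇒¬S4 , sequentialProduct⇔n≡1
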